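{- For every $n\ge1$, the map $\beta$ is a bijection from $\mathcal{B}_n$ onto $\mathcal{A}_n$, and for every $b\in\mathcal{B}_n$, $$(\mathrm{ASC},\mathrm{DIST},\mathrm{MAX},\mathrm{ZERO},\mathrm{RMIN})(b)=(\mathrm{ASC},\mathrm{DIST},\mathrm{MAX},\mathrm{ZERO},\mathrm{RMIN})(\beta(b)).$$
   Context: An inversion sequence of length $n$ is $s=(s_1,\dots,s_n)$ with $0\le s_i<i$. $\mathsf{asc}(s)=|\{i\in[n-1]:s_i<s_{i+1}\}|$; an ascent sequence is an inversion sequence with $s_i\le\mathsf{asc}(s_1,\dots,s_{i-1})+1$ for $2\le i\le n$; $\mathcal{A}_n$ is the set of ascent sequences of length $n$. $\mathcal{B}_n$ is the set of inversion sequences $b$ of length $n$ such that (a) if $b_i\ge b_{i+1}$ and $b_i=i-1$ then $b_j<j-1$ for all $j>i$; (b) if $b_i\ge b_{i+1}$ and $b_i<i-1$ then $i-1$ does not occur among $b_{i+1},\dots,b_n$. $\mathrm{NASC}(b)=\{i\in[n-1]:b_i\ge b_{i+1}\}$. The map $\beta$: given $b\in\mathcal{B}_n$ with $\mathrm{NASC}(b)=\{i_1>i_2>\dots>i_k\}$, for $i=i_1,i_2,\dots,i_k$ in this order, and for $j=i+1,\dots,n$ in order, if (currently) $b_i<i-1$ and $b_j>i-1$ then replace $b_j$ by $b_j-1$; $\beta(b)$ is the resulting sequence. Set-valued statistics of an inversion sequence $s$: $\mathrm{ASC}(s)=\{i\in[n-1]:s_i<s_{i+1}\}$; $\mathrm{DIST}(s)=\{2\le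 i\le n:s_i\ne0,\ s_i\ne s_j\ \forall j>i\}$; $\mathrm{MAX}(s)=\{i:s_i=i-1\}$; $\mathrm{ZERO}(s)=\{i:s_i=0\}$; $\mathrm{RMIN}(s)=\{i:s_i<s_j\ \forall j>i\}$. -}

module Defs where

open import Data.Nat using (ℕ; zero; suc; _+_; _∸_; _≤_; _<_; _<ᵇ_; pred)
open import Data.Bool using (Bool; true; false; if_then_else_; _∧_; not)
open import Data.List using (List; []; _∷_; length; foldl; map; upTo; reverse; filterᵇ)
open import Data.Product using (_×_)
open import Relation.Binary.PropositionalEquality using (_≡_; _≢_)

-- Sequences s = (s_1,…,s_n) are lists of naturals; positions are 1-based.
-- s ! i is s_i for 1 ≤ i ≤ length s (the value 0 returned outside this
-- range is never used: every use below is guarded by 1 ≤ i ≤ n).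
_!_ : List ℕ → ℕ → ℕ
[] ! _ = 0
(x ∷ xs) ! zero = 0
(x ∷ xs) ! suc zero = x
(x ∷ xs) ! suc (suc i) = xs ! suc i

updateAt : List ℕ → ℕ → (ℕ → ℕ) → List ℕ
updateAt [] _ f = []
updateAt (x ∷ xs) zero f = x ∷ xs
updateAt (x ∷ xs) (suc zero) f = f x ∷ xs
updateAt (x ∷ xs) (suc (suc i)) f = x ∷ updateAt xs (suc i) f

IsInversionSeq : ℕ → List ℕ → Set
IsInversionSeq n s = length s ≡ n × (∀ i → 1 ≤ i → i ≤ n → s ! i < i)

ascCount : List ℕ → ℕ → ℕ
ascCount s zero = 0
ascCount s (suc zero) = 0
ascCount s (suc (suc m)) =
  ascCount s (suc m) + (if (s ! suc m) <ᵇ (s ! suc (suc m)) then 1 else 0)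

IsAscentSeq : ℕ → List ℕ → Set
IsAscentSeq n s = IsInversionSeq n s
  × (∀ i → 2 ≤ i → i ≤ n → s ! i ≤ ascCount s (i ∸ 1) + 1)

IsB : ℕ → List ℕ → Set
IsB n b = IsInversionSeq n b
  × (∀ i → 1 ≤ i → i < n → b ! suc i ≤ b ! i → b ! i ≡ i ∸ 1 →
       ∀ j → i < j → j ≤ n → b ! j < j ∸ 1)
  × (∀ i → 1 ≤ i → i < n → b ! suc i ≤ b ! i → b ! i < i ∸ 1 →
       ∀ j → i < j → j ≤ n → b ! j ≢ i ∸ 1)

rangeFrom : ℕ → ℕ → List ℕ
rangeFrom a k = map (λ t → t + a) (upTo k)

nascDesc : List ℕ → List ℕ
nascDesc b = reverse (filterᵇ (λ i → not ((b ! i) <ᵇ (b ! suc i)))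
                              (rangeFrom 1 (length b ∸ 1)))

βinner : ℕ → List ℕ → ℕ → List ℕ
βinner i s j =
  if ((s ! i) <ᵇ (i ∸ 1)) ∧ ((i ∸ 1) <ᵇ (s ! j)) then updateAt s j pred else s

βstep : ℕ → List ℕ → List ℕ
βstep i s = foldl (βinner i) s (rangeFrom (suc i) (length s ∸ i))

-- β(b): process i ∈ NASC(b) (computed from the original b) in decreasing order
β : List ℕ → List ℕ
β b = foldl (λ s i → βstep i s) b (nascDesc b)

-- set-valued statistics, as predicates on positions
ASC : List ℕ → ℕ → Set
ASC s i = 1 ≤ i × i < length s × s ! i < s ! suc i

DIST : List ℕ → ℕ → Set
DIST s i = 2 ≤ i × i ≤ length s × s ! i ≢ 0
  × (∀ j → i < j → j ≤ length s → s ! i ≢ s ! j)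

MAX : List ℕ → ℕ → Set
MAX s i = 1 ≤ i × i ≤ length s × s ! i ≡ i ∸ 1

ZERO : List ℕ → ℕ → Set
ZERO s i = 1 ≤ i × i ≤ length s × s ! i ≡ 0

RMIN : List ℕ → ℕ → Set
RMIN s i = 1 ≤ i × i ≤ length s × (∀ j → i < j → j ≤ length s → s ! i < s ! j)

-- Call i a low non-ascent of b if b_i ≥ b_{i+1} and b_i < i − 1: these are the only
-- indices at which β lowers anything, and each entry b_j is lowered once for every low
-- non-ascent i ≤ b_j. Hence β(b)_j = rank_b(b_j), where rank_b(x) counts the indices
-- 1 ≤ i ≤ x that are not low non-ascents. For b ∈ ℬ, condition (b) makes b_i + 1 never a
-- low non-ascent, so rank_b is strictly increasing across the entries of b: β preserves
-- the relative order of entries, which gives the five statistics and asc(β(b)) = asc(b),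
-- while condition (a) bounds rank_b(b_i) by one more than the ascent count of b_1 … b_{i−1}.
-- Conversely, for an ascent sequence a, rank_a attains each a_j at some x < j such that
-- x + 1 is not a low non-ascent; these x form a sequence of ℬ with the same low
-- non-ascents as a, hence a preimage of a. Comparing ranks at the first position where
-- two sequences of ℬ differ shows that β is injective.

module Submission where

open import Defs
open import Data.Nat
  using (ℕ; zero; suc; _+_; _∸_; _≤_; _<_; _<ᵇ_; _≤ᵇ_; pred; z≤n; s≤s; z<s; _≤?_; _<?_; _≟_)
open import Data.Nat.Properties
open import Data.Bool using (Bool; true; false; if_then_else_; _∧_; not; T)
open import Data.Bool.Properties using (∧-zeroʳ; ∧-identityʳ)
open import Data.List using (List; []; _∷_; length; foldl; foldr; map; filterᵇ; applyUpTo)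
open import Data.List.Properties using (reverse-foldl; map-upTo; length-map)
open import Data.Product using (_×_; _,_; proj₁; proj₂; Σ-syntax)
open import Data.Sum using (_⊎_; inj₁; inj₂; map₂)
open import Data.Empty using (⊥; ⊥-elim)
open import Function using (_∘_; case_of_)
open import Function.Bundles using (_⇔_; mk⇔; module Equivalence)
open import Relation.Binary.PropositionalEquality
open import Relation.Binary.Definitions using (tri<; tri≈; tri>)
open import Relation.Nullary using (yes; no; Dec)
open import Relation.Nullary.Decidable using (dec-true; dec-false)
open import Algebra.Properties.CommutativeSemigroup +-commutativeSemigroup using (interchange)

<ᵇ-true : ∀ {m n} → m < n → (m <ᵇ n) ≡ true
<ᵇ-true {m} {n} = dec-true (m <? n)

<ᵇ-false : ∀ {m n} → n ≤ m → (m <ᵇ n) ≡ false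
<ᵇ-false {m} {n} n≤m = dec-false (m <? n) (≤⇒≯ n≤m)

≤ᵇ-true : ∀ {m n} → m ≤ n → (m ≤ᵇ n) ≡ true
≤ᵇ-true {m} {n} = dec-true (m ≤? n)

≤ᵇ-false : ∀ {m n} → n < m → (m ≤ᵇ n) ≡ false
≤ᵇ-false {m} {n} n<m = dec-false (m ≤? n) (<⇒≱ n<m)

<ᵇ-false⁻ : ∀ {m n} → (m <ᵇ n) ≡ false → n ≤ m
<ᵇ-false⁻ {m} {n} e = ≮⇒≥ (λ m<n → subst T e (<⇒<ᵇ m<n))

<ᵇ-cong : ∀ {m n m′ n′} → m < n ⇔ m′ < n′ → (m <ᵇ n) ≡ (m′ <ᵇ n′)
<ᵇ-cong {m} {n} m<n⇔m′<n′ with m <? n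
... | yes m<n = trans (<ᵇ-true m<n) (sym (<ᵇ-true (Equivalence.to m<n⇔m′<n′ m<n)))
... | no m≮n =
  trans (<ᵇ-false (≮⇒≥ m≮n)) (sym (<ᵇ-false (≮⇒≥ (m≮n ∘ Equivalence.from m<n⇔m′<n′))))

<⇒≤∸1 : ∀ {m n} → m < n → m ≤ n ∸ 1
<⇒≤∸1 {n = suc n} (s≤s m≤n) = m≤n

indicator : Bool → ℕ
indicator c = if c then 1 else 0

indicator≤1 : ∀ c → indicator c ≤ 1
indicator≤1 true = ≤-refl
indicator≤1 false = z≤n

indicator-+-not : ∀ c → indicator c + indicator (not c) ≡ 1
indicator-+-not true = refl
indicator-+-not false = refl

-- Counting

count : (ℕ → Bool) → ℕ → ℕ → ℕ
count p a zero = 0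
count p a (suc j) = count p a j + indicator ((a ≤ᵇ j) ∧ p j)

module _ (p : ℕ → Bool) where

  count-≡0 : ∀ a j → j ≤ a → count p a j ≡ 0
  count-≡0 a zero _ = refl
  count-≡0 a (suc j) j<a
    rewrite count-≡0 a j (<⇒≤ j<a) | ≤ᵇ-false {a} {j} j<a = refl

  count-unfold : ∀ a j → a < j → count p a j ≡ indicator (p a) + count p (suc a) j
  count-unfold a (suc j) a<1+j with a ≟ j
  ... | yes refl
    rewrite count-≡0 a a ≤-refl | ≤ᵇ-true {a} {a} ≤-refl
          | count-≡0 (suc a) a (n≤1+n a) | ≤ᵇ-false {suc a} {a} ≤-refl
    = +-comm 0 (indicator (p a))
  ... | no a≢j
    rewrite count-unfold a j (≤∧≢⇒< (≤-pred a<1+j) a≢j) | ≤ᵇ-true {a} {j} (≤-pred a<1+j)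
          | ≤ᵇ-true {suc a} {j} (≤∧≢⇒< (≤-pred a<1+j) a≢j)
    = +-assoc (indicator (p a)) (count p (suc a) j) (indicator (p j))

  count-skip : ∀ a j → p a ≡ false → count p a j ≡ count p (suc a) j
  count-skip a j pa≡false with a <? j
  ... | yes a<j rewrite count-unfold a j a<j | pa≡false = refl
  ... | no a≮j
    rewrite count-≡0 a j (≮⇒≥ a≮j) | count-≡0 (suc a) j (≤-trans (≮⇒≥ a≮j) (n≤1+n a)) = refl

  count-≤ : ∀ a j → count p a j ≤ j ∸ a
  count-≤ a zero = z≤n
  count-≤ a (suc j) with a ≤? j
  ... | yes a≤j = begin
    count p a j + indicator _  ≤⟨ +-mono-≤ (count-≤ a j) (indicator≤1 _) ⟩
    j ∸ a + 1                  ≡⟨ +-comm (j ∸ a) 1 ⟩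
    suc (j ∸ a)                ≡⟨ +-∸-assoc 1 a≤j ⟨
    suc j ∸ a                  ∎
    where open ≤-Reasoning
  ... | no a≰j rewrite count-≡0 a (suc j) (≰⇒> a≰j) = z≤n

  count-mono-≤ : ∀ a {j j′} → j ≤ j′ → count p a j ≤ count p a j′
  count-mono-≤ a {j} {zero} z≤n = ≤-refl
  count-mono-≤ a {j} {suc j′} j≤1+j′ with j ≟ suc j′
  ... | yes refl = ≤-refl
  ... | no j≢1+j′ = ≤-trans (count-mono-≤ a (≤-pred (≤∧≢⇒< j≤1+j′ j≢1+j′))) (m≤m+n _ _)

  count-stable : ∀ a t j → t ≤ j → (∀ i → t ≤ i → p i ≡ false) → count p a j ≡ count p a t
  count-stable a t zero z≤n _ = refl
  count-stable a t (suc j) t≤1+j none with t ≟ suc j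
  ... | yes refl = refl
  ... | no t≢1+j rewrite none j (≤-pred (≤∧≢⇒< t≤1+j t≢1+j)) | ∧-zeroʳ (a ≤ᵇ j)
    = trans (+-identityʳ _) (count-stable a t j (≤-pred (≤∧≢⇒< t≤1+j t≢1+j)) none)

count-cong : ∀ p q a j → (∀ i → a ≤ i → i < j → p i ≡ q i) → count p a j ≡ count q a j
count-cong p q a zero _ = refl
count-cong p q a (suc j) p≗q =
  cong₂ _+_ (count-cong p q a j (λ i a≤i i<j → p≗q i a≤i (m<n⇒m<1+n i<j))) last
  where
    last : indicator ((a ≤ᵇ j) ∧ p j) ≡ indicator ((a ≤ᵇ j) ∧ q j)
    last with a ≤? j
    ... | yes a≤j = cong (λ c → indicator ((a ≤ᵇ j) ∧ c)) (p≗q j a≤j ≤-refl)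
    ... | no a≰j rewrite ≤ᵇ-false (≰⇒> a≰j) = refl

count-+-count-not : ∀ p a j → a ≤ j → count p a j + count (not ∘ p) a j ≡ j ∸ a
count-+-count-not p a zero z≤n = refl
count-+-count-not p a (suc j) a≤1+j with a ≟ suc j
... | yes refl rewrite count-≡0 p (suc j) (suc j) ≤-refl
                     | count-≡0 (not ∘ p) (suc j) (suc j) ≤-refl | n∸n≡0 j = refl
... | no a≢1+j = step (≤-pred (≤∧≢⇒< a≤1+j a≢1+j))
  where
  step : a ≤ j → count p a (suc j) + count (not ∘ p) a (suc j) ≡ suc j ∸ a
  step a≤j rewrite ≤ᵇ-true {a} {j} a≤j = begin
    count p a j + indicator (p j) + (count (not ∘ p) a j + indicator (not (p j)))
      ≡⟨ interchange (count p a j) (indicator (p j)) (count (not ∘ p) a j) _ ⟩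
    (count p a j + count (not ∘ p) a j) + (indicator (p j) + indicator (not (p j)))
      ≡⟨ cong₂ _+_ (count-+-count-not p a j a≤j) (indicator-+-not (p j)) ⟩
    j ∸ a + 1
      ≡⟨ +-comm (j ∸ a) 1 ⟩
    suc (j ∸ a)
      ≡⟨ +-∸-assoc 1 a≤j ⟨
    suc j ∸ a ∎
    where open ≡-Reasoning

count-none : ∀ p a j → (∀ i → a ≤ i → i < j → p i ≡ false) → count p a j ≡ 0
count-none p a j none = trans (count-cong p (λ _ → false) a j none) (count-false j)
  where
    count-false : ∀ j → count (λ _ → false) a j ≡ 0
    count-false zero = refl
    count-false (suc j) rewrite ∧-zeroʳ (a ≤ᵇ j) | count-false j = refl

count-all : ∀ p a j → a ≤ j → (∀ i → a ≤ i → i < j → p i ≡ true) → count p a j ≡ j ∸ a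
count-all p a j a≤j all = begin
  count p a j                            ≡⟨ +-identityʳ _ ⟨
  count p a j + 0                        ≡⟨ cong (count p a j +_) (count-none (not ∘ p) a j none) ⟨
  count p a j + count (not ∘ p) a j      ≡⟨ count-+-count-not p a j a≤j ⟩
  j ∸ a                                  ∎
  where
    open ≡-Reasoning
    none : ∀ i → a ≤ i → i < j → not (p i) ≡ false
    none i a≤i i<j = cong not (all i a≤i i<j)

count-≤ᵇ-≤ : ∀ (p : ℕ → Bool) x a j → count (λ i → p i ∧ (i ≤ᵇ x)) a j ≤ suc x ∸ a
count-≤ᵇ-≤ p x a j with j ≤? suc x
... | yes j≤1+x = ≤-trans (count-≤ (λ i → p i ∧ (i ≤ᵇ x)) a j) (∸-monoˡ-≤ a j≤1+x)
... | no j≰1+x = begin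
  count p′ a j        ≡⟨ count-stable p′ a (suc x) j (<⇒≤ (≰⇒> j≰1+x)) beyond ⟩
  count p′ a (suc x)  ≤⟨ count-≤ p′ a (suc x) ⟩
  suc x ∸ a           ∎
  where
    open ≤-Reasoning
    p′ : ℕ → Bool
    p′ i = p i ∧ (i ≤ᵇ x)
    beyond : ∀ i → suc x ≤ i → p′ i ≡ false
    beyond i x<i = trans (cong (p i ∧_) (≤ᵇ-false x<i)) (∧-zeroʳ (p i))

-- Unfolding β

!-updateAt-pred : ∀ s a → updateAt s a pred ! a ≡ pred (s ! a)
!-updateAt-pred [] a = refl
!-updateAt-pred (x ∷ s) zero = refl
!-updateAt-pred (x ∷ s) (suc zero) = refl
!-updateAt-pred (x ∷ s) (suc (suc a)) = !-updateAt-pred s (suc a)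

!-updateAt-≢ : ∀ s a f {j} → j ≢ a → updateAt s a f ! j ≡ s ! j
!-updateAt-≢ [] a f j≢a = refl
!-updateAt-≢ (x ∷ s) zero f j≢a = refl
!-updateAt-≢ (x ∷ s) (suc zero) f {zero} j≢a = refl
!-updateAt-≢ (x ∷ s) (suc zero) f {suc zero} j≢a = ⊥-elim (j≢a refl)
!-updateAt-≢ (x ∷ s) (suc zero) f {suc (suc j)} j≢a = refl
!-updateAt-≢ (x ∷ s) (suc (suc a)) f {zero} j≢a = refl
!-updateAt-≢ (x ∷ s) (suc (suc a)) f {suc zero} j≢a = refl
!-updateAt-≢ (x ∷ s) (suc (suc a)) f {suc (suc j)} j≢a =
  !-updateAt-≢ s (suc a) f (j≢a ∘ cong suc)

length-updateAt : ∀ s a f → length (updateAt s a f) ≡ length s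
length-updateAt [] a f = refl
length-updateAt (x ∷ s) zero f = refl
length-updateAt (x ∷ s) (suc zero) f = refl
length-updateAt (x ∷ s) (suc (suc a)) f = cong suc (length-updateAt s (suc a) f)

lowersAt : ℕ → ℕ → ℕ → Bool
lowersAt i u v = (u <ᵇ i ∸ 1) ∧ (i ∸ 1 <ᵇ v)

predIf : Bool → ℕ → ℕ
predIf c x = if c then pred x else x

!-βinner-self : ∀ i s j → βinner i s j ! j ≡ predIf (lowersAt i (s ! i) (s ! j)) (s ! j)
!-βinner-self i s j with lowersAt i (s ! i) (s ! j)
... | true = !-updateAt-pred s j
... | false = refl

!-βinner-≢ : ∀ i s j {l} → l ≢ j → βinner i s j ! l ≡ s ! l
!-βinner-≢ i s j l≢j with lowersAt i (s ! i) (s ! j)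
... | true = !-updateAt-≢ s j pred l≢j
... | false = refl

length-βinner : ∀ i s j → length (βinner i s j) ≡ length s
length-βinner i s j with lowersAt i (s ! i) (s ! j)
... | true = length-updateAt s j pred
... | false = refl

interval : ℕ → ℕ → List ℕ
interval a zero = []
interval a (suc k) = a ∷ interval (suc a) k

applyUpTo-+≡interval : ∀ k a (f : ℕ → ℕ) → (∀ t → f t ≡ t + a) → applyUpTo f k ≡ interval a k
applyUpTo-+≡interval zero a f f≗+a = refl
applyUpTo-+≡interval (suc k) a f f≗+a =
  cong₂ _∷_ (f≗+a 0)
    (applyUpTo-+≡interval k (suc a) (f ∘ suc) (λ t → trans (f≗+a (suc t)) (sym (+-suc t a))))

rangeFrom≡interval : ∀ a k → rangeFrom a k ≡ interval a k
rangeFrom≡interval a k =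
  trans (map-upTo (_+ a) k) (applyUpTo-+≡interval k a (_+ a) (λ _ → refl))

length-interval : ∀ a m → length (interval a m) ≡ m
length-interval a zero = refl
length-interval a (suc m) = cong suc (length-interval (suc a) m)

!-map-interval : ∀ (f : ℕ → ℕ) m a k → k < m → map f (interval a m) ! suc k ≡ f (a + k)
!-map-interval f (suc m) a zero _ = cong f (sym (+-identityʳ a))
!-map-interval f (suc m) a (suc k) (s≤s k<m) =
  trans (!-map-interval f m (suc a) k k<m) (cong f (sym (+-suc a k)))

sweep : ℕ → List ℕ → ℕ → ℕ → List ℕ
sweep i s a m = foldl (βinner i) s (interval a m)

length-sweep : ∀ i s a m → length (sweep i s a m) ≡ length s
length-sweep i s a zero = refl
length-sweep i s a (suc m) = trans (length-sweep i (βinner i s a) (suc a) m) (length-βinner i s a)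

!-sweep-outside : ∀ i s a m {j} → j < a ⊎ a + m ≤ j → sweep i s a m ! j ≡ s ! j
!-sweep-outside i s a zero _ = refl
!-sweep-outside i s a (suc m) {j} outside =
  trans (!-sweep-outside i (βinner i s a) (suc a) m (shrink outside)) (!-βinner-≢ i s a (≢a outside))
  where
    shrink : j < a ⊎ a + suc m ≤ j → j < suc a ⊎ suc a + m ≤ j
    shrink (inj₁ j<a) = inj₁ (m<n⇒m<1+n j<a)
    shrink (inj₂ a+1+m≤j) = inj₂ (subst (_≤ j) (+-suc a m) a+1+m≤j)
    ≢a : j < a ⊎ a + suc m ≤ j → j ≢ a
    ≢a (inj₁ j<a) refl = <-irrefl refl j<a
    ≢a (inj₂ a+1+m≤j) refl = <-irrefl refl (≤-trans (m<m+n a z<s) a+1+m≤j)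

!-sweep-inside : ∀ i s a m {j} → i < a → a ≤ j → j < a + m →
                 sweep i s a m ! j ≡ predIf (lowersAt i (s ! i) (s ! j)) (s ! j)
!-sweep-inside i s a zero {j} i<a a≤j j<a+0 =
  ⊥-elim (<-irrefl refl (≤-trans j<a+0 (≤-trans (≤-reflexive (+-identityʳ a)) a≤j)))
!-sweep-inside i s a (suc m) {j} i<a a≤j j<a+1+m with a ≟ j
... | yes refl =
  trans (!-sweep-outside i (βinner i s a) (suc a) m (inj₁ ≤-refl)) (!-βinner-self i s a)
... | no a≢j
  rewrite !-sweep-inside i (βinner i s a) (suc a) m (m<n⇒m<1+n i<a) (≤∧≢⇒< a≤j a≢j)
            (subst (j <_) (+-suc a m) j<a+1+m)
        | !-βinner-≢ i s a (λ i≡a → <-irrefl i≡a i<a)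
        | !-βinner-≢ i s a (a≢j ∘ sym) = refl

βstep≡sweep : ∀ i s → βstep i s ≡ sweep i s (suc i) (length s ∸ i)
βstep≡sweep i s = cong (foldl (βinner i) s) (rangeFrom≡interval (suc i) (length s ∸ i))

length-βstep : ∀ i s → length (βstep i s) ≡ length s
length-βstep i s rewrite βstep≡sweep i s = length-sweep i s (suc i) (length s ∸ i)

!-βstep-≤ : ∀ i s {j} → j ≤ i → βstep i s ! j ≡ s ! j
!-βstep-≤ i s j≤i rewrite βstep≡sweep i s = !-sweep-outside i s (suc i) (length s ∸ i) (inj₁ (s≤s j≤i))

!-βstep-> : ∀ i s {j} → i < j → j ≤ length s →
            βstep i s ! j ≡ predIf (lowersAt i (s ! i) (s ! j)) (s ! j)
!-βstep-> i s {j} i<j j≤len rewrite βstep≡sweep i s =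
  !-sweep-inside i s (suc i) (length s ∸ i) ≤-refl i<j
    (s≤s (≤-trans j≤len (≤-reflexive (sym (m+[n∸m]≡n (<⇒≤ (<-≤-trans i<j j≤len)))))))

length-β : ∀ b → length (β b) ≡ length b
length-β b = go (nascDesc b) b
  where
    go : ∀ is s → length (foldl (λ s i → βstep i s) s is) ≡ length s
    go [] s = refl
    go (i ∷ is) s = trans (go is (βstep i s)) (length-βstep i s)

nasc : List ℕ → ℕ → Bool
nasc b i = not ((b ! i) <ᵇ (b ! suc i))

-- the indices at which β actually lowers later entries
lowNasc : List ℕ → ℕ → Bool
lowNasc b i = nasc b i ∧ ((b ! i) <ᵇ (i ∸ 1))

lowNascUpTo : List ℕ → ℕ → ℕ → Bool
lowNascUpTo b x i = lowNasc b i ∧ (i ≤ᵇ x)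

βFrom : List ℕ → ℕ → ℕ → List ℕ
βFrom b k m = foldr βstep b (filterᵇ (nasc b) (interval k m))

β≡βFrom : ∀ b → β b ≡ βFrom b 1 (length b ∸ 1)
β≡βFrom b rewrite reverse-foldl (λ s i → βstep i s) b
                    (filterᵇ (λ i → nasc b i) (rangeFrom 1 (length b ∸ 1)))
                | rangeFrom≡interval 1 (length b ∸ 1) = refl

length-foldr-βstep : ∀ b is → length (foldr βstep b is) ≡ length b
length-foldr-βstep b [] = refl
length-foldr-βstep b (i ∷ is) = trans (length-βstep i (foldr βstep b is)) (length-foldr-βstep b is)

k∸1<x∸C : ∀ {k x C} → 1 ≤ k → k ≤ x → C ≤ x ∸ k → k ∸ 1 < x ∸ C
k∸1<x∸C {k} {x} {C} 1≤k k≤x C≤x∸k = begin-strict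
  k ∸ 1          <⟨ ∸-monoʳ-< {n = 1} {0} z<s 1≤k ⟩
  k ∸ 0          ≡⟨ m∸[m∸n]≡n k≤x ⟨
  x ∸ (x ∸ k)    ≤⟨ ∸-monoʳ-≤ x C≤x∸k ⟩
  x ∸ C          ∎
  where open ≤-Reasoning

-- When k ≤ x the current value x ∸ C still exceeds k ∸ 1; when x < k the
-- bound on C forces C ≡ 0 and x is too small to be lowered.
predIf-∸ : ∀ c x C k → 1 ≤ k → C ≤ x ∸ k →
           predIf (c ∧ (k ∸ 1 <ᵇ x ∸ C)) (x ∸ C) ≡ x ∸ (indicator (c ∧ (k ≤ᵇ x)) + C)
predIf-∸ false x C k 1≤k C≤x∸k = refl
predIf-∸ true x C k 1≤k C≤x∸k with k ≤? x
... | yes k≤x rewrite ≤ᵇ-true k≤x | <ᵇ-true (k∸1<x∸C {k} {x} {C} 1≤k k≤x C≤x∸k) =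
  pred[m∸n]≡m∸[1+n] x C
... | no k≰x
  rewrite ≤ᵇ-false (≰⇒> k≰x) | n≤0⇒n≡0 (≤-trans C≤x∸k (≤-reflexive (m≤n⇒m∸n≡0 (<⇒≤ (≰⇒> k≰x)))))
        | <ᵇ-false {k ∸ 1} {x} (∸-monoˡ-≤ 1 (≰⇒> k≰x)) = refl

!-βstep-count : ∀ b k s → 1 ≤ k → nasc b k ≡ true → length s ≡ length b →
  (∀ {j} → j ≤ length b → s ! j ≡ b ! j ∸ count (lowNascUpTo b (b ! j)) (suc k) j) →
  ∀ {j} → j ≤ length b → βstep k s ! j ≡ b ! j ∸ count (lowNascUpTo b (b ! j)) k j
!-βstep-count b k s 1≤k nasc≡true length≡ s! {j} j≤n with k <? j
... | no k≮j = begin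
  βstep k s ! j                          ≡⟨ !-βstep-≤ k s (≮⇒≥ k≮j) ⟩
  s ! j                                  ≡⟨ s! j≤n ⟩
  x ∸ count (lowNascUpTo b x) (suc k) j  ≡⟨ cong (x ∸_) (count-≡0 _ (suc k) j (m≤n⇒m≤1+n (≮⇒≥ k≮j))) ⟩
  x ∸ 0                                  ≡⟨ cong (x ∸_) (count-≡0 _ k j (≮⇒≥ k≮j)) ⟨
  x ∸ count (lowNascUpTo b x) k j        ∎
  where
    open ≡-Reasoning
    x = b ! j
... | yes k<j = begin
  βstep k s ! j
    ≡⟨ !-βstep-> k s k<j (subst (j ≤_) (sym length≡) j≤n) ⟩
  predIf (lowersAt k (s ! k) (s ! j)) (s ! j)
    ≡⟨ cong₂ (λ u v → predIf (lowersAt k u v) v) s!k (s! j≤n) ⟩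
  predIf ((b ! k <ᵇ k ∸ 1) ∧ (k ∸ 1 <ᵇ x ∸ C)) (x ∸ C)
    ≡⟨ predIf-∸ (b ! k <ᵇ k ∸ 1) x C k 1≤k (count-≤ᵇ-≤ (lowNasc b) x (suc k) j) ⟩
  x ∸ (indicator ((b ! k <ᵇ k ∸ 1) ∧ (k ≤ᵇ x)) + C)
    ≡⟨ cong (λ c → x ∸ (indicator ((c ∧ (b ! k <ᵇ k ∸ 1)) ∧ (k ≤ᵇ x)) + C)) nasc≡true ⟨
  x ∸ (indicator (lowNascUpTo b x k) + C)
    ≡⟨ cong (x ∸_) (count-unfold _ k j k<j) ⟨
  x ∸ count (lowNascUpTo b x) k j
    ∎
  where
    open ≡-Reasoning
    x = b ! j
    C = count (lowNascUpTo b x) (suc k) j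
    s!k : s ! k ≡ b ! k
    s!k = trans (s! (<⇒≤ (<-≤-trans k<j j≤n))) (cong (b ! k ∸_) (count-≡0 _ (suc k) k (n≤1+n k)))

!-βFrom : ∀ b m k → 1 ≤ k → k + m ≡ length b → ∀ {j} → j ≤ length b →
          βFrom b k m ! j ≡ b ! j ∸ count (lowNascUpTo b (b ! j)) k j
!-βFrom b zero k 1≤k k+0≡n {j} j≤n =
  cong (b ! j ∸_) (sym (count-≡0 _ k j (≤-trans j≤n (≤-reflexive (trans (sym k+0≡n) (+-identityʳ k))))))
!-βFrom b (suc m) k 1≤k k+1+m≡n {j} j≤n with nasc b k in nasc≡
... | false = trans (IH j≤n) (cong (b ! j ∸_) (sym (count-skip _ k j lowNasc≡false)))
  where
    IH = !-βFrom b m (suc k) z<s (trans (sym (+-suc k m)) k+1+m≡n)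
    lowNasc≡false : lowNascUpTo b (b ! j) k ≡ false
    lowNasc≡false rewrite nasc≡ = refl
... | true = !-βstep-count b k (βFrom b (suc k) m) 1≤k nasc≡
               (length-foldr-βstep b (filterᵇ (nasc b) (interval (suc k) m)))
               (!-βFrom b m (suc k) z<s (trans (sym (+-suc k m)) k+1+m≡n)) j≤n

-- Ranks and ascent counts

rank : List ℕ → ℕ → ℕ
rank c x = count (not ∘ lowNasc c) 1 (suc x)

!-β : ∀ n b → IsInversionSeq n b → ∀ {j} → 1 ≤ j → j ≤ n → β b ! j ≡ rank b (b ! j)
!-β n b (length≡n , inv) {j} 1≤j j≤n = begin
  β b ! j                                ≡⟨ cong (_! j) (β≡βFrom b) ⟩
  βFrom b 1 (length b ∸ 1) ! j           ≡⟨ !-βFrom b _ 1 ≤-refl (m+[n∸m]≡n 1≤length) j≤length ⟩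
  x ∸ count (lowNascUpTo b x) 1 j        ≡⟨ cong (x ∸_) (count-stable _ 1 (suc x) j (inv j 1≤j j≤n) beyond) ⟩
  x ∸ count (lowNascUpTo b x) 1 (suc x)  ≡⟨ cong (x ∸_) (count-cong _ _ 1 (suc x) upTo≗) ⟩
  x ∸ low                                ≡⟨ cong (_∸ low) (count-+-count-not (lowNasc b) 1 (suc x) z<s) ⟨
  low + rank b x ∸ low                   ≡⟨ m+n∸m≡n low (rank b x) ⟩
  rank b x                               ∎
  where
    open ≡-Reasoning
    x = b ! j
    low = count (lowNasc b) 1 (suc x)
    j≤length = subst (j ≤_) (sym length≡n) j≤n
    1≤length = ≤-trans 1≤j j≤length
    beyond : ∀ i → suc x ≤ i → lowNascUpTo b x i ≡ false
    beyond i x<i = trans (cong (lowNasc b i ∧_) (≤ᵇ-false x<i)) (∧-zeroʳ _)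
    upTo≗ : ∀ i → 1 ≤ i → i < suc x → lowNascUpTo b x i ≡ lowNasc b i
    upTo≗ i _ i<1+x = trans (cong (lowNasc b i ∧_) (≤ᵇ-true (≤-pred i<1+x))) (∧-identityʳ _)

lowNasc-true : ∀ c k → c ! suc k ≤ c ! k → c ! k < k ∸ 1 → lowNasc c k ≡ true
lowNasc-true c k ≥next <k-1 rewrite <ᵇ-false ≥next | <ᵇ-true <k-1 = refl

lowNasc-false : ∀ c k → (c ! suc k ≤ c ! k → c ! k < k ∸ 1 → ⊥) → lowNasc c k ≡ false
lowNasc-false c k ¬low with c ! k <? c ! suc k
... | yes <next rewrite <ᵇ-true <next = refl
... | no ≮next with c ! k <? k ∸ 1
...   | yes <k-1 = ⊥-elim (¬low (≮⇒≥ ≮next) <k-1)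
...   | no ≮k-1 rewrite <ᵇ-false (≮⇒≥ ≮next) | <ᵇ-false (≮⇒≥ ≮k-1) = refl

lowNasc-false⁻ : ∀ c k → lowNasc c k ≡ false → c ! suc k ≤ c ! k → k ∸ 1 ≤ c ! k
lowNasc-false⁻ c k low≡false ≥next rewrite <ᵇ-false ≥next = <ᵇ-false⁻ low≡false

lowNasc-cong : ∀ c d k → c ! k ≡ d ! k → c ! suc k ≡ d ! suc k → lowNasc c k ≡ lowNasc d k
lowNasc-cong c d k eq eq′ rewrite eq | eq′ = refl

rank-≤ : ∀ c x → rank c x ≤ x
rank-≤ c x = count-≤ (not ∘ lowNasc c) 1 (suc x)

rank-mono-≤ : ∀ c {x y} → x ≤ y → rank c x ≤ rank c y
rank-mono-≤ c x≤y = count-mono-≤ (not ∘ lowNasc c) 1 (s≤s x≤y)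

rank-< : ∀ c {x y} → x < y → lowNasc c (suc x) ≡ false → rank c x < rank c y
rank-< c {x} {y} x<y low≡false = begin-strict
  rank c x                                         <⟨ n<1+n (rank c x) ⟩
  suc (rank c x)                                   ≡⟨ +-comm 1 (rank c x) ⟩
  rank c x + indicator (not false)                 ≡⟨ cong (λ l → rank c x + indicator (not l)) low≡false ⟨
  rank c (suc x)                                   ≤⟨ rank-mono-≤ c x<y ⟩
  rank c y                                         ∎
  where open ≤-Reasoning

rank-<⇔ : ∀ c {x y} → lowNasc c (suc x) ≡ false → x < y ⇔ rank c x < rank c y
rank-<⇔ c notLow = mk⇔ (λ x<y → rank-< c x<y notLow)
                       (λ rank< → ≰⇒> (λ y≤x → <⇒≱ rank< (rank-mono-≤ c y≤x)))

rank-cong : ∀ c d x → (∀ i → 1 ≤ i → i ≤ x → lowNasc c i ≡ lowNasc d i) → rank c x ≡ rank d x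
rank-cong c d x agree = count-cong _ _ 1 (suc x) (λ i 1≤i i<1+x → cong not (agree i 1≤i (≤-pred i<1+x)))

rankPreimage : List ℕ → ℕ → ℕ → ℕ
rankPreimage c v zero = 0
rankPreimage c v (suc y) = if v <ᵇ rank c y then rankPreimage c v y else y

rankPreimage-spec : ∀ c v y → v < rank c y →
  let x = rankPreimage c v y in x < y × rank c x ≡ v × lowNasc c (suc x) ≡ false
rankPreimage-spec c v (suc y) v<rank with v <? rank c y
... | yes v<rank′ rewrite <ᵇ-true v<rank′ =
  let (x<y , rank≡v , notLow) = rankPreimage-spec c v y v<rank′ in m<n⇒m<1+n x<y , rank≡v , notLow
... | no v≮rank′ rewrite <ᵇ-false (≮⇒≥ v≮rank′) = lastStep v<rank
  where
    lastStep : v < rank c y + indicator (not (lowNasc c (suc y))) →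
               y < suc y × rank c y ≡ v × lowNasc c (suc y) ≡ false
    lastStep v<rank with lowNasc c (suc y)
    ... | true  = ⊥-elim (v≮rank′ (subst (v <_) (+-identityʳ (rank c y)) v<rank))
    ... | false = ≤-refl , ≤-antisym (≮⇒≥ v≮rank′) (≤-pred (subst (v <_) (+-comm (rank c y) 1) v<rank)) , refl

ascCount-≤ : ∀ s m → ascCount s (suc m) ≤ m
ascCount-≤ s zero = z≤n
ascCount-≤ s (suc m) =
  subst (ascCount s (suc (suc m)) ≤_) (+-comm m 1) (+-mono-≤ (ascCount-≤ s m) (indicator≤1 _))

ascCount-nonAscent : ∀ s m {i} → 1 ≤ i → i ≤ m → s ! suc i ≤ s ! i →
                     2 + ascCount s (suc m) ≤ suc m
ascCount-nonAscent s zero {i} 1≤i i≤0 _ = ⊥-elim (<-irrefl refl (≤-trans 1≤i i≤0))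
ascCount-nonAscent s (suc m) {i} 1≤i i≤1+m ≥next = byCases (i ≟ suc m)
  where
    byCases : Dec (i ≡ suc m) → 2 + ascCount s (suc (suc m)) ≤ suc (suc m)
    byCases (yes refl) rewrite <ᵇ-false ≥next | +-identityʳ (ascCount s (suc m)) =
      s≤s (s≤s (ascCount-≤ s m))
    byCases (no i≢1+m) = begin
      2 + (asc + indicator _)  ≤⟨ +-monoʳ-≤ 2 (+-monoʳ-≤ asc (indicator≤1 _)) ⟩
      2 + (asc + 1)            ≡⟨ cong (2 +_) (+-comm asc 1) ⟩
      suc (2 + asc)            ≤⟨ s≤s (ascCount-nonAscent s m 1≤i (≤-pred (≤∧≢⇒< i≤1+m i≢1+m)) ≥next) ⟩
      suc (suc m)              ∎
      where
        open ≤-Reasoning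
        asc = ascCount s (suc m)

ascCount-cong : ∀ s t m →
  (∀ i → 1 ≤ i → suc i ≤ m → ((s ! i) <ᵇ (s ! suc i)) ≡ ((t ! i) <ᵇ (t ! suc i))) →
  ascCount s m ≡ ascCount t m
ascCount-cong s t zero _ = refl
ascCount-cong s t (suc zero) _ = refl
ascCount-cong s t (suc (suc m)) same =
  cong₂ _+_ (ascCount-cong s t (suc m) (λ i 1≤i i<m → same i 1≤i (m≤n⇒m≤1+n i<m)))
            (cong indicator (same (suc m) z<s ≤-refl))

-- Sequences in ℬ

MaxNascBefore : List ℕ → ℕ → Set
MaxNascBefore b m = Σ[ k ∈ ℕ ] (1 ≤ k × k < m × b ! suc k ≤ b ! k × b ! k ≡ k ∸ 1)

MaxNascBefore-mono : ∀ {b m m′} → m ≤ m′ → MaxNascBefore b m → MaxNascBefore b m′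
MaxNascBefore-mono m≤m′ (k , 1≤k , k<m , rest) = k , 1≤k , <-≤-trans k<m m≤m′ , rest

module ℬ {n} b (b∈ℬ : IsB n b) where

  !< : ∀ {i} → 1 ≤ i → i ≤ n → b ! i < i
  !< = proj₂ (proj₁ b∈ℬ) _

  -- By condition (b), the value b_i could not recur at position i after a low non-ascent b_i + 1.
  lowNasc-suc-entry : ∀ {i} → 1 ≤ i → i ≤ n → lowNasc b (suc (b ! i)) ≡ false
  lowNasc-suc-entry {i} 1≤i i≤n = lowNasc-false b (suc x) notLow
    where
      x = b ! i
      notLow : b ! suc (suc x) ≤ b ! suc x → b ! suc x < x → ⊥
      notLow ≥next <x with suc x ≟ i
      ... | yes 1+x≡i = <-irrefl (cong (b !_) 1+x≡i) <x
      ... | no 1+x≢i = proj₂ (proj₂ b∈ℬ) (suc x) z<s (<-≤-trans 1+x<i i≤n) ≥next <x i 1+x<i i≤n refl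
        where 1+x<i = ≤∧≢⇒< (!< 1≤i i≤n) 1+x≢i

  <-after-MaxNasc : ∀ {j} → j ≤ n → MaxNascBefore b j → b ! j < j ∸ 1
  <-after-MaxNasc j≤n (k , 1≤k , k<j , ≥next , max) =
    proj₁ (proj₂ b∈ℬ) k 1≤k (<-≤-trans k<j j≤n) ≥next max _ k<j j≤n

  maxEntry⊎MaxNasc : ∀ m → 1 ≤ m → m ≤ n → b ! m ≡ m ∸ 1 ⊎ MaxNascBefore b m
  maxEntry⊎MaxNasc (suc zero) _ 1≤n = inj₁ (n<1⇒n≡0 (!< ≤-refl 1≤n))
  maxEntry⊎MaxNasc (suc (suc m)) _ 2+m≤n with maxEntry⊎MaxNasc (suc m) z<s (≤-trans (n≤1+n _) 2+m≤n)
  ... | inj₂ seen = inj₂ (MaxNascBefore-mono {b} (n≤1+n _) seen)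
  ... | inj₁ max with b ! suc (suc m) ≤? b ! suc m
  ...   | yes ≥next = inj₂ (suc m , z<s , ≤-refl , ≥next , max)
  ...   | no ≰ = inj₁ (≤-antisym (≤-pred (!< z<s 2+m≤n)) (subst (_< b ! suc (suc m)) max (≰⇒> ≰)))

  rank-maxEntry : ∀ {i} → 1 ≤ i → i ≤ n → b ! i ≡ i ∸ 1 → rank b (b ! i) ≡ i ∸ 1
  rank-maxEntry {suc i} _ 1+i≤n max =
    trans (cong (rank b) max)
          (count-all (not ∘ lowNasc b) 1 (suc i) z<s (λ k 1≤k k≤i → cong not (notLow k 1≤k k≤i)))
    where
      notLow : ∀ k → 1 ≤ k → k < suc i → lowNasc b k ≡ false
      notLow k 1≤k k≤i = lowNasc-false b k λ _ <k-1 →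
        case maxEntry⊎MaxNasc k 1≤k (≤-trans (<⇒≤ k≤i) 1+i≤n) of λ where
          (inj₁ maxₖ) → <-irrefl maxₖ <k-1
          (inj₂ seen) → <-irrefl max (<-after-MaxNasc 1+i≤n (MaxNascBefore-mono {b} (<⇒≤ k≤i) seen))

  rank-<-entries : ∀ {i j} → 1 ≤ i → i ≤ n → b ! i < b ! j ⇔ rank b (b ! i) < rank b (b ! j)
  rank-<-entries 1≤i i≤n = rank-<⇔ b (lowNasc-suc-entry 1≤i i≤n)

  rank-injective-entries : ∀ {i j} → 1 ≤ i → i ≤ n → 1 ≤ j → j ≤ n →
                           rank b (b ! i) ≡ rank b (b ! j) → b ! i ≡ b ! j
  rank-injective-entries {i} {j} 1≤i i≤n 1≤j j≤n rank≡ with <-cmp (b ! i) (b ! j)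
  ... | tri< lt _ _ = ⊥-elim (<-irrefl rank≡ (Equivalence.to (rank-<-entries 1≤i i≤n) lt))
  ... | tri≈ _ eq _ = eq
  ... | tri> _ _ gt = ⊥-elim (<-irrefl (sym rank≡) (Equivalence.to (rank-<-entries 1≤j j≤n) gt))

  -- Apart from the ascents, only a non-ascent at a maximal entry escapes being a low
  -- non-ascent, and by condition (a) at most one such index occurs.
  RankBound : ℕ → Set
  RankBound k = rank b k ≤ ascCount b (suc k)
              ⊎ (rank b k ≤ 1 + ascCount b (suc k) × MaxNascBefore b (suc k))

  rank≤ascCount : ∀ k → suc k ≤ n → RankBound k
  rank≤ascCount zero _ = inj₁ z≤n
  rank≤ascCount (suc k) 2+k≤n with rank≤ascCount k (≤-trans (n≤1+n _) 2+k≤n)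
                                 | b ! suc k <? b ! suc (suc k) | b ! suc k <? k
  ... | inj₁ r≤a | yes asc | _ rewrite <ᵇ-true asc = inj₁ (+-monoˡ-≤ 1 r≤a)
  ... | inj₂ (r≤1+a , seen) | yes asc | _ rewrite <ᵇ-true asc =
    inj₂ (+-monoˡ-≤ 1 r≤1+a , MaxNascBefore-mono {b} (n≤1+n _) seen)
  ... | IH | no nasc | yes low rewrite <ᵇ-false (≮⇒≥ nasc) | <ᵇ-true low
                                     | +-identityʳ (rank b k) | +-identityʳ (ascCount b (suc k)) =
    map₂ (λ (r≤1+a , seen) → r≤1+a , MaxNascBefore-mono {b} (n≤1+n _) seen) IH
  ... | inj₁ r≤a | no nasc | no notLow rewrite <ᵇ-false (≮⇒≥ nasc) | <ᵇ-false (≮⇒≥ notLow)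
                                            | +-identityʳ (ascCount b (suc k)) =
    inj₂ (subst (rank b k + 1 ≤_) (+-comm (ascCount b (suc k)) 1) (+-monoˡ-≤ 1 r≤a)
         , suc k , z<s , ≤-refl , ≮⇒≥ nasc , max)
    where max = ≤-antisym (≤-pred (!< z<s (≤-trans (n≤1+n _) 2+k≤n))) (≮⇒≥ notLow)
  ... | inj₂ (_ , seen) | no nasc | no notLow =
    ⊥-elim (notLow (<-after-MaxNasc (≤-trans (n≤1+n _) 2+k≤n) seen))

  rank-entry≤ascCount : ∀ {i} → 2 ≤ i → i ≤ n → rank b (b ! i) ≤ ascCount b (i ∸ 1) + 1
  rank-entry≤ascCount {suc (suc m)} (s≤s (s≤s z≤n)) i≤n with rank≤ascCount m (≤-trans (n≤1+n _) i≤n)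
                                            | b ! suc (suc m) ≟ suc m
  ... | inj₁ r≤a | yes max rewrite max = +-mono-≤ r≤a (indicator≤1 _)
  ... | inj₂ (_ , seen) | yes max =
    ⊥-elim (<-irrefl max (<-after-MaxNasc i≤n (MaxNascBefore-mono {b} (n≤1+n _) seen)))
  ... | bound | no notMax =
    ≤-trans (rank-mono-≤ b (≤-pred (≤∧≢⇒< (≤-pred (!< z<s i≤n)) notMax))) (weaken bound)
    where
      weaken : RankBound m → rank b m ≤ ascCount b (suc m) + 1
      weaken (inj₁ r≤a) = ≤-trans r≤a (m≤m+n _ 1)
      weaken (inj₂ (r≤1+a , _)) = subst (rank b m ≤_) (+-comm 1 _) r≤1+a

module ℬβ {n} b (b∈ℬ : IsB n b) where
  open ℬ b b∈ℬ

  private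
    length≡n : length b ≡ n
    length≡n = proj₁ (proj₁ b∈ℬ)

    length-β≡n : length (β b) ≡ n
    length-β≡n = trans (length-β b) length≡n

    β!≡rank : ∀ {j} → 1 ≤ j → j ≤ n → β b ! j ≡ rank b (b ! j)
    β!≡rank = !-β n b (proj₁ b∈ℬ)

  β-<-entries : ∀ {i j} → 1 ≤ i → i ≤ n → 1 ≤ j → j ≤ n → b ! i < b ! j ⇔ β b ! i < β b ! j
  β-<-entries {i} {j} 1≤i i≤n 1≤j j≤n =
    subst₂ (λ u v → b ! i < b ! j ⇔ u < v) (sym (β!≡rank 1≤i i≤n)) (sym (β!≡rank 1≤j j≤n))
           (rank-<-entries 1≤i i≤n)

  β-≡-entries : ∀ {i j} → 1 ≤ i → i ≤ n → 1 ≤ j → j ≤ n → b ! i ≡ b ! j ⇔ β b ! i ≡ β b ! j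
  β-≡-entries 1≤i i≤n 1≤j j≤n = mk⇔
    (λ eq → trans (β!≡rank 1≤i i≤n) (trans (cong (rank b) eq) (sym (β!≡rank 1≤j j≤n))))
    (λ eq → rank-injective-entries 1≤i i≤n 1≤j j≤n
              (trans (sym (β!≡rank 1≤i i≤n)) (trans eq (β!≡rank 1≤j j≤n))))

  β-≡0 : ∀ {i} → 1 ≤ i → i ≤ n → b ! i ≡ 0 ⇔ β b ! i ≡ 0
  β-≡0 {i} 1≤i i≤n = mk⇔
    (λ eq → trans (Equivalence.to (β-≡-entries 1≤i i≤n ≤-refl 1≤n) (trans eq (sym b!1≡0))) β!1≡0)
    (λ eq → trans (Equivalence.from (β-≡-entries 1≤i i≤n ≤-refl 1≤n) (trans eq (sym β!1≡0))) b!1≡0)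
    where
      1≤n = ≤-trans 1≤i i≤n
      b!1≡0 : b ! 1 ≡ 0
      b!1≡0 = n<1⇒n≡0 (!< ≤-refl 1≤n)
      β!1≡0 : β b ! 1 ≡ 0
      β!1≡0 = trans (β!≡rank ≤-refl 1≤n) (cong (rank b) b!1≡0)

  β-max : ∀ {i} → 1 ≤ i → i ≤ n → b ! i ≡ i ∸ 1 ⇔ β b ! i ≡ i ∸ 1
  β-max {i} 1≤i i≤n = mk⇔
    (λ max → trans (β!≡rank 1≤i i≤n) (rank-maxEntry 1≤i i≤n max))
    (λ max → ≤-antisym (<⇒≤∸1 (!< 1≤i i≤n))
                       (≤-trans (≤-reflexive (trans (sym max) (β!≡rank 1≤i i≤n))) (rank-≤ b (b ! i))))

  ascCount-β : ∀ m → m ≤ n → ascCount (β b) m ≡ ascCount b m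
  ascCount-β m m≤n = ascCount-cong (β b) b m λ i 1≤i 1+i≤m →
    let 1+i≤n = ≤-trans 1+i≤m m≤n in sym (<ᵇ-cong (β-<-entries 1≤i (<⇒≤ 1+i≤n) z<s 1+i≤n))

  β-isAscentSeq : IsAscentSeq n (β b)
  β-isAscentSeq = (length-β≡n , β!<) , β!≤ascCount+1
    where
      β!< : ∀ i → 1 ≤ i → i ≤ n → β b ! i < i
      β!< i 1≤i i≤n = subst (_< i) (sym (β!≡rank 1≤i i≤n)) (≤-<-trans (rank-≤ b _) (!< 1≤i i≤n))
      β!≤ascCount+1 : ∀ i → 2 ≤ i → i ≤ n → β b ! i ≤ ascCount (β b) (i ∸ 1) + 1
      β!≤ascCount+1 i 2≤i i≤n =
        subst₂ _≤_ (sym (β!≡rank (≤-trans (n≤1+n 1) 2≤i) i≤n))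
                   (cong (_+ 1) (sym (ascCount-β (i ∸ 1) (≤-trans (m∸n≤m i 1) i≤n))))
                   (rank-entry≤ascCount 2≤i i≤n)

  private
    ≤n : ∀ {i} → i ≤ length b → i ≤ n
    ≤n = subst (_ ≤_) length≡n

    ≤n′ : ∀ {i} → i ≤ length (β b) → i ≤ n
    ≤n′ = subst (_ ≤_) length-β≡n

    ≤β : ∀ {i} → i ≤ length b → i ≤ length (β b)
    ≤β = subst (_ ≤_) (sym (length-β b))

    ≤b : ∀ {i} → i ≤ length (β b) → i ≤ length b
    ≤b = subst (_ ≤_) (length-β b)

  open Equivalence using (to; from)

  ASC-β : ∀ i → ASC b i ⇔ ASC (β b) i
  ASC-β i = mk⇔
    (λ (1≤i , i<len , lt) → 1≤i , ≤β i<len , to (entries 1≤i (≤n i<len)) lt)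
    (λ (1≤i , i<len , lt) → 1≤i , ≤b i<len , from (entries 1≤i (≤n′ i<len)) lt)
    where
      entries : 1 ≤ i → i < n → b ! i < b ! suc i ⇔ β b ! i < β b ! suc i
      entries 1≤i i<n = β-<-entries 1≤i (<⇒≤ i<n) z<s i<n

  DIST-β : ∀ i → DIST b i ⇔ DIST (β b) i
  DIST-β i = mk⇔
    (λ (2≤i , i≤len , nz , distinct) → 2≤i , ≤β i≤len ,
       (λ z → nz (from (β-≡0 (2≤⇒1≤ 2≤i) (≤n i≤len)) z)) ,
       λ j i<j j≤len eq → distinct j i<j (≤b j≤len) (from (entries 2≤i (≤n i≤len) i<j (≤n′ j≤len)) eq))
    (λ (2≤i , i≤len , nz , distinct) → 2≤i , ≤b i≤len ,
       (λ z → nz (to (β-≡0 (2≤⇒1≤ 2≤i) (≤n′ i≤len)) z)) ,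
       λ j i<j j≤len eq → distinct j i<j (≤β j≤len) (to (entries 2≤i (≤n′ i≤len) i<j (≤n j≤len)) eq))
    where
      2≤⇒1≤ : 2 ≤ i → 1 ≤ i
      2≤⇒1≤ = ≤-trans (n≤1+n 1)
      entries : ∀ {j} → 2 ≤ i → i ≤ n → i < j → j ≤ n → b ! i ≡ b ! j ⇔ β b ! i ≡ β b ! j
      entries 2≤i i≤n i<j j≤n = β-≡-entries (2≤⇒1≤ 2≤i) i≤n (≤-trans (2≤⇒1≤ 2≤i) (<⇒≤ i<j)) j≤n

  MAX-β : ∀ i → MAX b i ⇔ MAX (β b) i
  MAX-β i = mk⇔
    (λ (1≤i , i≤len , max) → 1≤i , ≤β i≤len , to (β-max 1≤i (≤n i≤len)) max)
    (λ (1≤i , i≤len , max) → 1≤i , ≤b i≤len , from (β-max 1≤i (≤n′ i≤len)) max)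

  ZERO-β : ∀ i → ZERO b i ⇔ ZERO (β b) i
  ZERO-β i = mk⇔
    (λ (1≤i , i≤len , z) → 1≤i , ≤β i≤len , to (β-≡0 1≤i (≤n i≤len)) z)
    (λ (1≤i , i≤len , z) → 1≤i , ≤b i≤len , from (β-≡0 1≤i (≤n′ i≤len)) z)

  RMIN-β : ∀ i → RMIN b i ⇔ RMIN (β b) i
  RMIN-β i = mk⇔
    (λ (1≤i , i≤len , min) → 1≤i , ≤β i≤len ,
       λ j i<j j≤len → to (entries 1≤i (≤n i≤len) i<j (≤n′ j≤len)) (min j i<j (≤b j≤len)))
    (λ (1≤i , i≤len , min) → 1≤i , ≤b i≤len ,
       λ j i<j j≤len → from (entries 1≤i (≤n′ i≤len) i<j (≤n j≤len)) (min j i<j (≤β j≤len)))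
    where
      entries : ∀ {j} → 1 ≤ i → i ≤ n → i < j → j ≤ n → b ! i < b ! j ⇔ β b ! i < β b ! j
      entries 1≤i i≤n i<j j≤n = β-<-entries 1≤i i≤n (≤-trans 1≤i (<⇒≤ i<j)) j≤n

-- Injectivity

!-extensional : ∀ s t → length s ≡ length t →
                (∀ j → 1 ≤ j → j ≤ length s → s ! j ≡ t ! j) → s ≡ t
!-extensional [] [] _ _ = refl
!-extensional (x ∷ s) (y ∷ t) length≡ same =
  cong₂ _∷_ (same 1 ≤-refl (s≤s z≤n))
    (!-extensional s t (suc-injective length≡)
      λ { (suc j) _ j≤len → same (suc (suc j)) z<s (s≤s j≤len) })

-- Below the first disagreement both sequences have the same low non-ascents.
rank-first-difference : ∀ {n} b b′ → IsB n b → IsB n b′ → ∀ {j} →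
  (∀ k → 1 ≤ k → k ≤ j → b ! k ≡ b′ ! k) → suc j ≤ n → b ! suc j < b′ ! suc j →
  rank b (b ! suc j) < rank b′ (b′ ! suc j)
rank-first-difference {n} b b′ b∈ℬ b′∈ℬ {j} agree 1+j≤n x<x′ = begin-strict
  rank b x    ≡⟨ rank-cong b b′ x (λ i 1≤i i≤x →
                   lowNasc-cong b b′ i (agree i 1≤i (≤-trans i≤x x≤j))
                                       (agree (suc i) z<s (≤-trans (s≤s i≤x) 1+x≤j))) ⟩
  rank b′ x   <⟨ rank-< b′ x<x′ notLow′ ⟩
  rank b′ x′  ∎
  where
    open ≤-Reasoning
    x = b ! suc j
    x′ = b′ ! suc j
    1+x≤j : suc x ≤ j
    1+x≤j = <-≤-trans x<x′ (≤-pred (ℬ.!< b′ b′∈ℬ z<s 1+j≤n))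
    x≤j = <⇒≤ 1+x≤j
    notLow′ : lowNasc b′ (suc x) ≡ false
    notLow′ = lowNasc-false b′ (suc x) (byCases (suc x ≟ j))
      where
        byCases : Dec (suc x ≡ j) → b′ ! suc (suc x) ≤ b′ ! suc x → b′ ! suc x < x → ⊥
        byCases (yes 1+x≡j) ≥next <x =
          <-asym x<x′ (≤-<-trans (subst (λ t → b′ ! suc t ≤ b′ ! suc x) 1+x≡j ≥next) <x)
        byCases (no 1+x≢j) ≥next <x =
          <⇒≱ (subst (_< x) (sym eq₁) <x)
              (lowNasc-false⁻ b (suc x) (ℬ.lowNasc-suc-entry b b∈ℬ z<s 1+j≤n)
                                        (subst₂ _≤_ (sym eq₂) (sym eq₁) ≥next))
          where
            2+x≤j = ≤∧≢⇒< 1+x≤j 1+x≢j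
            eq₁ = agree (suc x) z<s 1+x≤j
            eq₂ = agree (suc (suc x)) z<s 2+x≤j

β-injective : ∀ {n} b b′ → IsB n b → IsB n b′ → β b ≡ β b′ → b ≡ b′
β-injective {n} b b′ b∈ℬ b′∈ℬ βb≡βb′ =
  !-extensional b b′ (trans length≡n (sym length′≡n))
    λ j 1≤j j≤len → agreeUpTo j (subst (j ≤_) length≡n j≤len) j 1≤j ≤-refl
  where
    length≡n = proj₁ (proj₁ b∈ℬ)
    length′≡n = proj₁ (proj₁ b′∈ℬ)
    sameRank : ∀ {j} → 1 ≤ j → j ≤ n → rank b (b ! j) ≡ rank b′ (b′ ! j)
    sameRank 1≤j j≤n = trans (sym (!-β n b (proj₁ b∈ℬ) 1≤j j≤n))
                             (trans (cong (_! _) βb≡βb′) (!-β n b′ (proj₁ b′∈ℬ) 1≤j j≤n))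
    agreeUpTo : ∀ j → j ≤ n → ∀ k → 1 ≤ k → k ≤ j → b ! k ≡ b′ ! k
    agreeUpTo zero _ k 1≤k k≤0 = ⊥-elim (<-irrefl refl (≤-trans 1≤k k≤0))
    agreeUpTo (suc j) 1+j≤n k 1≤k k≤1+j with k ≟ suc j
    ... | no k≢1+j = agreeUpTo j (≤-trans (n≤1+n j) 1+j≤n) k 1≤k (≤-pred (≤∧≢⇒< k≤1+j k≢1+j))
    ... | yes refl with <-cmp (b ! suc j) (b′ ! suc j)
    ...   | tri≈ _ eq _ = eq
    ...   | tri< lt _ _ = ⊥-elim (<-irrefl (sameRank z<s 1+j≤n)
                              (rank-first-difference b b′ b∈ℬ b′∈ℬ below 1+j≤n lt))
      where below = agreeUpTo j (≤-trans (n≤1+n j) 1+j≤n)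
    ...   | tri> _ _ gt = ⊥-elim (<-irrefl (sym (sameRank z<s 1+j≤n))
                              (rank-first-difference b′ b b′∈ℬ b∈ℬ below′ 1+j≤n gt))
      where below′ = λ k 1≤k k≤j → sym (agreeUpTo j (≤-trans (n≤1+n j) 1+j≤n) k 1≤k k≤j)

-- Surjectivity

module 𝒜 {n} a (a∈𝒜 : IsAscentSeq n a) where

  !< : ∀ {i} → 1 ≤ i → i ≤ n → a ! i < i
  !< = proj₂ (proj₁ a∈𝒜) _

  !≤ascCount+1 : ∀ {i} → 2 ≤ i → i ≤ n → a ! i ≤ ascCount a (i ∸ 1) + 1
  !≤ascCount+1 = proj₂ a∈𝒜 _

  !≤ascCount : ∀ m → suc m ≤ n → a ! suc m ≤ ascCount a (suc m)
  !≤ascCount zero 1≤n = ≤-reflexive (n<1⇒n≡0 (!< ≤-refl 1≤n))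
  !≤ascCount (suc m) 2+m≤n with !≤ascCount m (≤-trans (n≤1+n _) 2+m≤n)
                              | a ! suc (suc m) ≤? ascCount a (suc m)
  ... | _ | yes ≤asc = ≤-trans ≤asc (m≤m+n _ _)
  ... | IH | no ≰asc rewrite <ᵇ-true (≤-<-trans IH (≰⇒> ≰asc)) = !≤ascCount+1 (s≤s (s≤s z≤n)) 2+m≤n

  <-after-maxNasc : ∀ {i j} → 1 ≤ i → a ! suc i ≤ a ! i → a ! i ≡ i ∸ 1 →
                    i < j → j ≤ n → a ! j < j ∸ 1
  <-after-maxNasc {i} {suc j} 1≤i ≥next max i<1+j 1+j≤n with i ≟ j
  ... | yes refl = ≤-<-trans (subst (a ! suc i ≤_) max ≥next) (∸-monoˡ-< (n<1+n i) 1≤i)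
  ... | no i≢j = past (≤∧≢⇒< (≤-pred i<1+j) i≢j) 1+j≤n
    where
      past : ∀ {j} → i < j → suc j ≤ n → a ! suc j < j
      past {suc m} (s≤s i≤m) 2+m≤n = begin-strict
        a ! suc (suc m)           ≤⟨ !≤ascCount+1 (s≤s (s≤s z≤n)) 2+m≤n ⟩
        ascCount a (suc m) + 1    ≡⟨ +-comm (ascCount a (suc m)) 1 ⟩
        suc (ascCount a (suc m))  <⟨ ascCount-nonAscent a m 1≤i i≤m ≥next ⟩
        suc m                     ∎
        where open ≤-Reasoning

  ascCount<rank⊎increasing : ∀ m → suc m ≤ n →
    ascCount a (suc m) < rank a m ⊎ (a ! suc m ≡ m × ascCount a (suc m) ≤ rank a m)
  ascCount<rank⊎increasing zero 1≤n = inj₂ (n<1⇒n≡0 (!< ≤-refl 1≤n) , z≤n)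
  ascCount<rank⊎increasing (suc m) 2+m≤n with ascCount<rank⊎increasing m (≤-trans (n≤1+n _) 2+m≤n)
                                            | a ! suc m <? a ! suc (suc m)
  ... | inj₁ asc<rank | yes ascent rewrite <ᵇ-true ascent = inj₁ (+-monoˡ-≤ 1 asc<rank)
  ... | inj₂ (max , asc≤rank) | yes ascent rewrite <ᵇ-true ascent =
    inj₂ ( ≤-antisym (≤-pred (!< z<s 2+m≤n)) (subst (_< a ! suc (suc m)) max ascent)
         , +-monoˡ-≤ 1 asc≤rank)
  ... | inj₁ asc<rank | no nasc rewrite <ᵇ-false (≮⇒≥ nasc) | +-identityʳ (ascCount a (suc m)) =
    inj₁ (≤-trans asc<rank (m≤m+n _ _))
  ... | inj₂ (max , asc≤rank) | no nasc
    rewrite <ᵇ-false (≮⇒≥ nasc) | +-identityʳ (ascCount a (suc m)) | <ᵇ-false (≤-reflexive (sym max)) =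
    inj₁ (subst (_≤ rank a m + 1) (+-comm (ascCount a (suc m)) 1) (+-monoˡ-≤ 1 asc≤rank))

  !<rank : ∀ {j} → 1 ≤ j → j ≤ n → a ! j < rank a j
  !<rank {suc m} _ 1+m≤n with ascCount<rank⊎increasing m 1+m≤n
  ... | inj₁ asc<rank = begin-strict
    a ! suc m            ≤⟨ !≤ascCount m 1+m≤n ⟩
    ascCount a (suc m)   <⟨ asc<rank ⟩
    rank a m             ≤⟨ rank-mono-≤ a (n≤1+n m) ⟩
    rank a (suc m)       ∎
    where open ≤-Reasoning
  ... | inj₂ (max , asc≤rank) = begin-strict
    a ! suc m            ≤⟨ !≤ascCount m 1+m≤n ⟩
    ascCount a (suc m)   ≤⟨ asc≤rank ⟩
    rank a m             <⟨ rank-< a (n<1+n m) (lowNasc-false a (suc m) (λ _ → <-irrefl max)) ⟩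
    rank a (suc m)       ∎
    where open ≤-Reasoning

  rank-pred≡!⇒max : ∀ {k} → 1 ≤ k → k ≤ n → rank a (k ∸ 1) ≡ a ! k → a ! k ≡ k ∸ 1
  rank-pred≡!⇒max {suc m} _ 1+m≤n rank≡ with ascCount<rank⊎increasing m 1+m≤n
  ... | inj₁ asc<rank = ⊥-elim (<-irrefl (sym rank≡) (≤-<-trans (!≤ascCount m 1+m≤n) asc<rank))
  ... | inj₂ (max , _) = max

  entry : ℕ → ℕ
  entry j = rankPreimage a (a ! j) j

  entry-spec : ∀ {j} → 1 ≤ j → j ≤ n →
    entry j < j × rank a (entry j) ≡ a ! j × lowNasc a (suc (entry j)) ≡ false
  entry-spec {j} 1≤j j≤n = rankPreimage-spec a (a ! j) j (!<rank 1≤j j≤n)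

  preimage : List ℕ
  preimage = map entry (interval 1 n)

  !-preimage : ∀ {j} → 1 ≤ j → j ≤ n → preimage ! j ≡ entry j
  !-preimage {suc k} _ j≤n = !-map-interval entry n 1 k j≤n

  preimage-isInversionSeq : IsInversionSeq n preimage
  preimage-isInversionSeq =
      trans (length-map entry (interval 1 n)) (length-interval 1 n)
    , λ j 1≤j j≤n → subst (_< j) (sym (!-preimage 1≤j j≤n)) (proj₁ (entry-spec 1≤j j≤n))

  private
    entry< : ∀ {j} → 1 ≤ j → j ≤ n → entry j < j
    entry< 1≤j j≤n = proj₁ (entry-spec 1≤j j≤n)

    rank-entry : ∀ {j} → 1 ≤ j → j ≤ n → rank a (entry j) ≡ a ! j
    rank-entry 1≤j j≤n = proj₁ (proj₂ (entry-spec 1≤j j≤n))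

    notLow-entry : ∀ {j} → 1 ≤ j → j ≤ n → lowNasc a (suc (entry j)) ≡ false
    notLow-entry 1≤j j≤n = proj₂ (proj₂ (entry-spec 1≤j j≤n))

  preimage-<-entries : ∀ {i j} → 1 ≤ i → i ≤ n → 1 ≤ j → j ≤ n →
                       preimage ! i < preimage ! j ⇔ a ! i < a ! j
  preimage-<-entries {i} {j} 1≤i i≤n 1≤j j≤n =
    subst₂ (λ u v → u < v ⇔ a ! i < a ! j) (sym (!-preimage 1≤i i≤n)) (sym (!-preimage 1≤j j≤n))
      (subst₂ (λ u v → entry i < entry j ⇔ u < v) (rank-entry 1≤i i≤n) (rank-entry 1≤j j≤n)
        (rank-<⇔ a (notLow-entry 1≤i i≤n)))

  preimage-<-pred : ∀ {k} → 1 ≤ k → k ≤ n → preimage ! k < k ∸ 1 ⇔ a ! k < k ∸ 1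
  preimage-<-pred {k} 1≤k k≤n rewrite !-preimage 1≤k k≤n = mk⇔
    (λ lt → ≤-<-trans (subst (_≤ entry k) (rank-entry 1≤k k≤n) (rank-≤ a (entry k))) lt)
    (λ lt → ≤∧≢⇒< (<⇒≤∸1 (entry< 1≤k k≤n))
              (λ eq → <-irrefl (rank-pred≡!⇒max 1≤k k≤n
                                  (trans (cong (rank a) (sym eq)) (rank-entry 1≤k k≤n))) lt))

  lowNasc-preimage : ∀ {k} → 1 ≤ k → suc k ≤ n → lowNasc preimage k ≡ lowNasc a k
  lowNasc-preimage 1≤k 1+k≤n = cong₂ (λ u v → not u ∧ v)
    (<ᵇ-cong (preimage-<-entries 1≤k (<⇒≤ 1+k≤n) z<s 1+k≤n))
    (<ᵇ-cong (preimage-<-pred 1≤k (<⇒≤ 1+k≤n)))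

  β-preimage : β preimage ≡ a
  β-preimage = !-extensional (β preimage) a (trans length-β≡n (sym (proj₁ (proj₁ a∈𝒜))))
                 (λ j 1≤j j≤len → β-preimage-! 1≤j (subst (j ≤_) length-β≡n j≤len))
    where
      length-β≡n : length (β preimage) ≡ n
      length-β≡n = trans (length-β preimage) (proj₁ preimage-isInversionSeq)
      β-preimage-! : ∀ {j} → 1 ≤ j → j ≤ n → β preimage ! j ≡ a ! j
      β-preimage-! {j} 1≤j j≤n = begin
        β preimage ! j                ≡⟨ !-β n preimage preimage-isInversionSeq 1≤j j≤n ⟩
        rank preimage (preimage ! j)  ≡⟨ cong (rank preimage) (!-preimage 1≤j j≤n) ⟩
        rank preimage (entry j)       ≡⟨ rank-cong preimage a (entry j) sameLow ⟩
        rank a (entry j)              ≡⟨ rank-entry 1≤j j≤n ⟩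
        a ! j                         ∎
        where
          open ≡-Reasoning
          sameLow : ∀ i → 1 ≤ i → i ≤ entry j → lowNasc preimage i ≡ lowNasc a i
          sameLow i 1≤i i≤x = lowNasc-preimage 1≤i (≤-trans (s≤s i≤x) (≤-trans (entry< 1≤j j≤n) j≤n))

  preimage∈ℬ : IsB n preimage
  preimage∈ℬ = preimage-isInversionSeq , maxCondition , lowCondition
    where
      open Equivalence using (to; from)
      maxCondition : ∀ i → 1 ≤ i → i < n → preimage ! suc i ≤ preimage ! i →
                     preimage ! i ≡ i ∸ 1 → ∀ j → i < j → j ≤ n → preimage ! j < j ∸ 1
      maxCondition i 1≤i i<n ≥next max j i<j j≤n =
        from (preimage-<-pred (≤-trans 1≤i (<⇒≤ i<j)) j≤n) (<-after-maxNasc 1≤i a-≥next a-max i<j j≤n)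
        where
          a-max : a ! i ≡ i ∸ 1
          a-max = rank-pred≡!⇒max 1≤i (<⇒≤ i<n)
                    (trans (cong (rank a) (trans (sym max) (!-preimage 1≤i (<⇒≤ i<n))))
                           (rank-entry 1≤i (<⇒≤ i<n)))
          a-≥next : a ! suc i ≤ a ! i
          a-≥next = ≮⇒≥ (λ lt → <⇒≱ (from (preimage-<-entries 1≤i (<⇒≤ i<n) z<s i<n) lt) ≥next)
      lowCondition : ∀ i → 1 ≤ i → i < n → preimage ! suc i ≤ preimage ! i →
                     preimage ! i < i ∸ 1 → ∀ j → i < j → j ≤ n → preimage ! j ≢ i ∸ 1
      lowCondition i 1≤i i<n ≥next low j i<j j≤n !≡ = true≢false (begin
        true                       ≡⟨ lowNasc-true preimage i ≥next low ⟨
        lowNasc preimage i         ≡⟨ lowNasc-preimage 1≤i i<n ⟩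
        lowNasc a i                ≡⟨ cong (lowNasc a) (m+[n∸m]≡n 1≤i) ⟨
        lowNasc a (suc (i ∸ 1))    ≡⟨ cong (lowNasc a ∘ suc) (trans (sym !≡) (!-preimage 1≤j j≤n)) ⟩
        lowNasc a (suc (entry j))  ≡⟨ notLow-entry 1≤j j≤n ⟩
        false                      ∎)
        where
          open ≡-Reasoning
          1≤j = ≤-trans 1≤i (<⇒≤ i<j)
          true≢false : true ≢ false
          true≢false ()

proposition3p4 : (n : ℕ) → 1 ≤ n →
      ((b : List ℕ) → IsB n b → IsAscentSeq n (β b))
    × ((b b′ : List ℕ) → IsB n b → IsB n b′ → β b ≡ β b′ → b ≡ b′)
    × ((a : List ℕ) → IsAscentSeq n a → Σ[ b ∈ List ℕ ] (IsB n b × β b ≡ a))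
    × ((b : List ℕ) → IsB n b →
          (∀ i → ASC b i ⇔ ASC (β b) i)
        × (∀ i → DIST b i ⇔ DIST (β b) i)
        × (∀ i → MAX b i ⇔ MAX (β b) i)
        × (∀ i → ZERO b i ⇔ ZERO (β b) i)
        × (∀ i → RMIN b i ⇔ RMIN (β b) i))
-- Nothing in the argument needs n ≥ 1.
proposition3p4 n _ =
  (λ b b∈ℬ → ℬβ.β-isAscentSeq b b∈ℬ) ,
  (λ b b′ b∈ℬ b′∈ℬ → β-injective b b′ b∈ℬ b′∈ℬ) ,
  (λ a a∈𝒜 → 𝒜.preimage a a∈𝒜 , 𝒜.preimage∈ℬ a a∈𝒜 , 𝒜.β-preimage a a∈𝒜) ,
  (λ b b∈ℬ → let open ℬβ b b∈ℬ in ASC-β , DIST-β , MAX-β , ZERO-β , RMIN-β)
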